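{- Let $T$ be a basic tile or a critical tile and let $\tau$ be any face of its underlying simplex not contained in its Morse face. Then the stellar subdivision $\mathrm{st}_\tau(T)$ carries a shellable $h$-tiling which uses a critical tile if and only if $T$ is critical, and in that case it uses exactly one critical tile, of the same index as $T$.
   Context: A relative simplex is a simplex (its underlying simplex) deprived of some proper faces. A basic tile of dimension $n$ and order $k\in\{0,\dots,n+1\}$ is an $n$-simplex deprived of $k$ of its $(n-1)$-faces; it has a unique face of least dimension $k-1$. A critical tile of dimension $n$ and index $k\in\{0,\dots,n\}$ is a basic tile of order $k$ deprived moreover of that $(k-1)$-dimensional face. The Morse face of a basic tile is empty; the Morse face of a critical tile of index $k$ with $1\le k\le n-1$ is the removed $(k-1)$-dimensional face, and it is empty for index $0$ (closed simplex) and index $n$ (open simplex). A relative simplex $P$ is regarded as the relative complex $\overline P\setminus L$, $L$ the subcomplex of removed faces. For a simplicial complex $K$ and a nonempty face $\tau$, $\mathrm{st}_\tau(K)$ is obtained by removing all simplices containing $\tau$ and adding a vertex $\hat\tau$ and all cones $\hat\tau*\rho$, $\rho$ ranging over faces not containing $\tau$ of simplices containing $\tau$; $\mathrm{st}_\tau(K\setminus L)=\mathrm{st}_\tau(K)\setminus\mathrm{st}_\tau(L)$ with $\mathrm{st}_\tau(L)=L$ if $\tau\notin L$. A tiling of a relative complex $K\setminus L$ is a partition of $|K|\setminus|L|$ into relative simplices with underlying simplices in $K$ such that for every $d\ge0$ the union of tiles of dimension $>d$ is closed; it is shellable if the tiles can be ordered $T_1,\dots,T_N$ with each $T_1\cup\dots\cup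 T_p$ closed. An $h$-tiling is a tiling by basic or critical tiles. -}

module Defs where

open import Data.Nat using (ℕ; zero; suc; _≤_; _<_; _+_; _∸_)
open import Data.Nat.Properties using (_≤?_)
open import Data.Bool using (Bool; true; false)
open import Data.Fin using (Fin; toℕ)
open import Data.Fin.Subset using (Subset; _⊆_; _∈_; _-_; ∣_∣; Nonempty; ⊥)
open import Data.Vec using (_∷_)
open import Data.Product using (Σ; _×_; _,_; ∃)
open import Data.Sum using (_⊎_)
open import Relation.Nullary using (¬_; yes; no)
open import Relation.Binary.PropositionalEquality using (_≡_; _≢_)

-- A simplex is a (nonempty) subset of Fin m.  A (sub)complex is given
-- by the predicate "ρ is a (nonempty) simplex of it".  Points of |K|
-- lie in exactly one open simplex, so partitions / closedness of
-- subsets of |K| \ |L| made of open simplices are expressed on the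
-- set of simplices of K not in L.

Cx : ℕ → Set₁
Cx m = Subset m → Set

closure : ∀ {m} → Subset m → Cx m
closure σ ρ = ρ ⊆ σ × Nonempty ρ

data Kind : Set where
  basic critical : Kind

-- A tile with underlying simplex 'simplex' (dimension ∣simplex∣ - 1).
-- 'least' is the set of vertices opposite to the removed facets
-- (i.e. the unique face of least dimension, of dimension k - 1 where
-- k = ∣least∣ is the number of removed facets).
-- basic tile of order k = ∣least∣ ∈ {0,…,n+1};
-- critical tile of index k = ∣least∣ ∈ {0,…,n}, i.e. least ≠ simplex.
record Tile (m : ℕ) : Set where
  field
    simplex  : Subset m
    least    : Subset m
    kind     : Kind
    nonempty : Nonempty simplex
    least⊆   : least ⊆ simplex
    crit-ok  : kind ≡ critical → least ≢ simplex
open Tile public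

dim : ∀ {m} → Tile m → ℕ
dim t = ∣ simplex t ∣ ∸ 1

order : ∀ {m} → Tile m → ℕ
order t = ∣ least t ∣

opposite : ∀ {m} → Subset m → Fin m → Subset m
opposite σ i = σ - i

InTile : ∀ {m} → Tile m → Subset m → Set
InTile t ρ =
  ρ ⊆ simplex t × Nonempty ρ
  × (∀ i → i ∈ least t → ¬ (ρ ⊆ opposite (simplex t) i))
  × (kind t ≡ critical → ρ ≢ least t)

-- Morse face: empty for basic tiles and for critical tiles of index 0
-- or n; the removed (k-1)-face for critical tiles of index 1 ≤ k ≤ n-1.
morseFace : ∀ {m} → Tile m → Subset m
morseFace t with kind t | 1 ≤? ∣ least t ∣ | ∣ least t ∣ + 2 ≤? ∣ simplex t ∣
... | critical | yes _ | yes _ = least t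
... | _        | _     | _     = ⊥

removed : ∀ {m} → Tile m → Cx m
removed t ρ = closure (simplex t) ρ × ¬ InTile t ρ

-- The new vertex τ̂ is the vertex 'zero' of
-- Fin (suc m); an old vertex v becomes 'suc v'.  So a subset
-- (b ∷ ρ) of Fin (suc m) is the simplex ρ (if b = false) or the cone
-- τ̂ * ρ (if b = true).

st : ∀ {m} → Subset m → Cx m → Cx (suc m)
st τ K (false ∷ ρ) = K ρ × ¬ (τ ⊆ ρ)
st τ K (true ∷ ρ)  = Σ (Subset _) λ s → K s × τ ⊆ s × ρ ⊆ s × ¬ (τ ⊆ ρ)

lift : ∀ {m} → Cx m → Cx (suc m)
lift K (false ∷ ρ) = K ρ
lift K (true ∷ ρ)  = Data.Empty.⊥
  where import Data.Empty

stSub : ∀ {m} → Subset m → Cx m → Cx (suc m)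
stSub τ L ρ = (L τ × st τ L ρ) ⊎ (¬ L τ × lift L ρ)

RelFace : ∀ {m} → Cx m → Cx m → Subset m → Set
RelFace K L ρ = K ρ × ¬ L ρ

ClosedUnion : ∀ {m N} → Cx m → Cx m → (Fin N → Tile m) → (Fin N → Set) → Set
ClosedUnion {N = N} K L ts P =
  ∀ (i : Fin N) → P i → ∀ ρ → InTile (ts i) ρ →
  ∀ ρ' → ρ' ⊆ ρ → RelFace K L ρ' →
  Σ (Fin N) λ j → P j × InTile (ts j) ρ'

record IsTiling {m N} (K L : Cx m) (ts : Fin N → Tile m) : Set where
  field
    underlying-in : ∀ i → K (simplex (ts i))
    sub          : ∀ i ρ → InTile (ts i) ρ → RelFace K L ρ
    cover-unique : ∀ ρ → RelFace K L ρ →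
                   Σ (Fin N) λ i → InTile (ts i) ρ × (∀ j → InTile (ts j) ρ → j ≡ i)
    dim-closed   : ∀ (d : ℕ) → ClosedUnion K L ts (λ i → d < dim (ts i))

IsShellableTiling : ∀ {m N} (K L : Cx m) (ts : Fin N → Tile m) → Set
IsShellableTiling {N = N} K L ts =
  IsTiling K L ts × (∀ (p : ℕ) → ClosedUnion K L ts (λ i → toℕ i < p))

{-# OPTIONS --safe #-}
-- Write σ for the simplex of T and κ for its least face, and list the vertices of τ as
-- e₀, …, e_{N-1} with those of κ first.  The facets of st_τ(σ) are the cones τ̂ * (σ - eᵢ),
-- and each face of the subdivided relative complex is assigned to the cone of the first eᵢ
-- it misses.  The faces assigned to cone i form an interval whose bottom is
-- (κ ∖ τ) ∪ {e_j | j < i}, together with τ̂ when eᵢ ∈ κ, so they form a basic or critical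
-- tile; faces of a face miss an earlier vertex, which gives the shelling.  The bottom is κ
-- itself only for the first eᵢ outside κ, which yields the unique critical tile when T is
-- critical.  If T is critical and τ ⊆ κ, then τ ⊄ Morse face forces κ to be a facet, so T is
-- the open simplex: tile that instead, and read its last cone, itself an open simplex, as a
-- critical tile of top index.
module Submission where

open import Defs
open import Data.Bool using (true; false) renaming (_≟_ to _≟ᵇ_)
open import Data.Empty using (⊥-elim)
open import Data.Fin as F using (Fin; toℕ; splitAt; _↑ˡ_; _↑ʳ_)
import Data.Fin.Properties as Fₚ
open import Data.Fin.Subset using (Subset; _⊆_; _∈_; _∉_; _-_; _─_; _∪_; ∣_∣; Nonempty; ⁅_⁆)
open import Data.Fin.Subset.Properties
open import Data.Nat using (ℕ; zero; suc; _≤_; _<_; _+_; _∸_; s≤s; z≤n)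
import Data.Nat.Properties as ℕₚ
open import Data.Product using (Σ; ∃; _×_; _,_; proj₁; proj₂; map₁; map₂)
open import Data.Sum using (_⊎_; inj₁; inj₂; [_,_]′)
open import Data.Vec using (_∷_; here; there; tabulate)
import Data.Vec.Properties as Vecₚ
open import Function.Properties.Equivalence using () renaming (refl to ⇔-refl; sym to ⇔-sym; trans to ⇔-trans)
open import Function using (_∘_; _⇔_; mk⇔; Equivalence)
open import Relation.Binary.PropositionalEquality
open import Relation.Nullary
open import Relation.Nullary.Decidable using (dec-true; dec-false; _×-dec_; _→-dec_; ¬?)
open import Relation.Unary using (Decidable)

open Equivalence using (to; from)

private variable
  n : ℕ

x∈p─q⇒x∉q : ∀ {x : Fin n} (p q : Subset n) → x ∈ p ─ q → x ∉ q
x∈p─q⇒x∉q (_ ∷ p) (true  ∷ q) ()                here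
x∈p─q⇒x∉q (_ ∷ p) (false ∷ q) here              ()
x∈p─q⇒x∉q (_ ∷ p) (_     ∷ q) (there x∈p─q) (there x∈q) = x∈p─q⇒x∉q p q x∈p─q x∈q

x∈p-y⇒x∈p : ∀ {x y : Fin n} (p : Subset n) → x ∈ p - y → x ∈ p
x∈p-y⇒x∈p {y = y} p = p─q⊆p p ⁅ y ⁆

x∈p-y⇒x≢y : ∀ {x y : Fin n} (p : Subset n) → x ∈ p - y → x ≢ y
x∈p-y⇒x≢y {y = y} p x∈p-y refl = x∈p─q⇒x∉q p ⁅ y ⁆ x∈p-y (x∈⁅x⁆ y)

x∉p-x : ∀ {x : Fin n} (p : Subset n) → x ∉ p - x
x∉p-x p x∈p-x = x∈p-y⇒x≢y p x∈p-x refl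

p⊆q-x⇔p⊆q∧x∉p : ∀ {p q : Subset n} {x} → p ⊆ q - x ⇔ (p ⊆ q × x ∉ p)
p⊆q-x⇔p⊆q∧x∉p {q = q} = mk⇔
  (λ p⊆q-x → (λ {y} y∈p → x∈p-y⇒x∈p q (p⊆q-x y∈p)) , λ x∈p → x∉p-x q (p⊆q-x x∈p))
  (λ (p⊆q , x∉p) {y} y∈p → x∈p∧x≢y⇒x∈p-y (p⊆q y∈p) λ { refl → x∉p y∈p })

p-x⊆q⇒p⊆q : ∀ {p q : Subset n} {x} → x ∈ q → p - x ⊆ q → p ⊆ q
p-x⊆q⇒p⊆q {p = p} {x = x} x∈q p-x⊆q {y} y∈p with y Fₚ.≟ x
... | yes refl = x∈q
... | no  y≢x  = p-x⊆q (x∈p∧x≢y⇒x∈p-y y∈p y≢x)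

∪-⊆ : ∀ {p q r : Subset n} → p ⊆ r → q ⊆ r → p ∪ q ⊆ r
∪-⊆ {p = p} {q = q} p⊆r q⊆r x∈p∪q = [ p⊆r , q⊆r ]′ (x∈p∪q⁻ p q x∈p∪q)

p─q⊆r⇔p⊆r∪q : ∀ {p q r : Subset n} → p ─ q ⊆ r ⇔ p ⊆ r ∪ q
p─q⊆r⇔p⊆r∪q {p = p} {q = q} {r = r} = mk⇔ to′ from′
  where
  to′ : p ─ q ⊆ r → p ⊆ r ∪ q
  to′ p─q⊆r {x} x∈p with x ∈? q
  ... | yes x∈q = q⊆p∪q r q x∈q
  ... | no  x∉q = p⊆p∪q q (p─q⊆r (x∈p∧x∉q⇒x∈p─q x∈p x∉q))
  from′ : p ⊆ r ∪ q → p ─ q ⊆ r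
  from′ p⊆r∪q x∈p─q with x∈p∪q⁻ r q (p⊆r∪q (p─q⊆p p q x∈p─q))
  ... | inj₁ x∈r = x∈r
  ... | inj₂ x∈q = ⊥-elim (x∈p─q⇒x∉q p q x∈p─q x∈q)

⊈⇒∃∉ : ∀ {p q : Subset n} → ¬ p ⊆ q → ∃ λ x → x ∈ p × x ∉ q
⊈⇒∃∉ {p = p} {q = q} p⊈q with Fₚ.any? (λ x → (x ∈? p) ×-dec ¬? (x ∈? q))
... | yes witness = witness
... | no  none    = ⊥-elim (p⊈q λ {x} x∈p → decidable-stable (x ∈? q) λ x∉q → none (x , x∈p , x∉q))

suc∣p-x∣≡∣p∣ : ∀ {x : Fin n} (p : Subset n) → x ∈ p → suc ∣ p - x ∣ ≡ ∣ p ∣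
suc∣p-x∣≡∣p∣ {x = F.zero}  (true  ∷ p) here        = cong suc (cong ∣_∣ (p─⊥≡p p))
suc∣p-x∣≡∣p∣ {x = F.suc x} (true  ∷ p) (there x∈p) = cong suc (suc∣p-x∣≡∣p∣ p x∈p)
suc∣p-x∣≡∣p∣ {x = F.suc x} (false ∷ p) (there x∈p) = suc∣p-x∣≡∣p∣ p x∈p

p⊆q∧∣q∣≤∣p∣⇒p≡q : ∀ {p q : Subset n} → p ⊆ q → ∣ q ∣ ≤ ∣ p ∣ → p ≡ q
p⊆q∧∣q∣≤∣p∣⇒p≡q {p = p} {q = q} p⊆q ∣q∣≤∣p∣ with q ⊆? p
... | yes q⊆p = ⊆-antisym p⊆q q⊆p
... | no  q⊈p = ⊥-elim (ℕₚ.<⇒≱ (p⊂q⇒∣p∣<∣q∣ (p⊆q , ⊈⇒∃∉ q⊈p)) ∣q∣≤∣p∣)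

∣p-x∣≡∣p-y∣ : ∀ {p : Subset n} {x y} → x ∈ p → y ∈ p → ∣ p - x ∣ ≡ ∣ p - y ∣
∣p-x∣≡∣p-y∣ {p = p} x∈p y∈p = ℕₚ.suc-injective (trans (suc∣p-x∣≡∣p∣ p x∈p) (sym (suc∣p-x∣≡∣p∣ p y∈p)))

true≢false : true ≢ false
true≢false ()

∷⊆∷⇔ : ∀ {b c} {p q : Subset n} → (b ∷ p) ⊆ (c ∷ q) ⇔ ((b ≡ true → c ≡ true) × p ⊆ q)
∷⊆∷⇔ {b = b} {c} {p} {q} = mk⇔ split (λ (b⇒c , p⊆q) → cons b⇒c p⊆q)
  where
  head : ∀ {b c p q} → (b ∷ p) ⊆ (c ∷ q) → b ≡ true → c ≡ true
  head {true} {true}  _        refl = refl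
  head {true} {false} b∷p⊆c∷q refl with () ← b∷p⊆c∷q here
  cons : ∀ {b c p q} → (b ≡ true → c ≡ true) → p ⊆ q → (b ∷ p) ⊆ (c ∷ q)
  cons b⇒c p⊆q here with refl ← b⇒c refl = here
  cons b⇒c p⊆q (there x∈p) = there (p⊆q x∈p)
  split : (b ∷ p) ⊆ (c ∷ q) → (b ≡ true → c ≡ true) × p ⊆ q
  split b∷p⊆c∷q = head b∷p⊆c∷q , drop-∷-⊆ b∷p⊆c∷q

nonempty-∷⁻ : ∀ {p : Subset n} → Nonempty (false ∷ p) → Nonempty p
nonempty-∷⁻ (F.suc x , there x∈p) = x , x∈p

_≟ₛ_ : (p q : Subset n) → Dec (p ≡ q)
_≟ₛ_ = Vecₚ.≡-dec _≟ᵇ_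

subsetOf : {P : Fin n → Set} → Decidable P → Subset n
subsetOf P? = tabulate (does ∘ P?)

module _ {P : Fin n → Set} (P? : Decidable P) {x : Fin n} where

  ∈-subsetOf⁺ : P x → x ∈ subsetOf P?
  ∈-subsetOf⁺ px = Vecₚ.lookup⇒[]= x _ (trans (Vecₚ.lookup∘tabulate _ x) (dec-true (P? x) px))

  ∈-subsetOf⁻ : x ∈ subsetOf P? → P x
  ∈-subsetOf⁻ x∈ with P? x | trans (sym (Vecₚ.lookup∘tabulate (does ∘ P?) x)) (Vecₚ.[]=⇒lookup x∈)
  ... | yes px | _ = px

minimal : ∀ {N} {Q : Fin N → Set} → Decidable Q → ∀ {k} → Q k →
          ∃ λ i → Q i × (∀ j → toℕ j < toℕ i → ¬ Q j)
minimal {suc N} Q? qk with Q? F.zero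
... | yes q₀ = F.zero , q₀ , λ _ ()
minimal {suc N} Q? {F.zero}  q₀ | no ¬q₀ = ⊥-elim (¬q₀ q₀)
minimal {suc N} Q? {F.suc k} qk | no ¬q₀ with minimal (Q? ∘ F.suc) qk
... | i , qi , below = F.suc i , qi , λ where
  F.zero    _         → ¬q₀
  (F.suc j) (s≤s j<i) → below j j<i

greatest : ∀ {N} → Fin N → Σ (Fin N) λ i → ∀ (j : Fin N) → toℕ j ≤ toℕ i
greatest {suc N} _ = F.fromℕ N , λ j → subst (toℕ j ≤_) (sym (Fₚ.toℕ-fromℕ N)) (Fₚ.toℕ≤pred[n] j)

module _ {N m : ℕ} (e : Fin N → Fin m) where

  FirstMissing : Fin N → Subset m → Set
  FirstMissing i ρ = e i ∉ ρ × (∀ j → toℕ j < toℕ i → e j ∈ ρ)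

  firstMissing-exists : ∀ {ρ k} → e k ∉ ρ → ∃ λ i → FirstMissing i ρ
  firstMissing-exists {ρ} e[k]∉ρ with minimal (λ i → ¬? (e i ∈? ρ)) e[k]∉ρ
  ... | i , e[i]∉ρ , below = i , e[i]∉ρ , λ j j<i → decidable-stable (e j ∈? ρ) (below j j<i)

  firstMissing-antitone : ∀ {i j ρ ρ′} → ρ′ ⊆ ρ → FirstMissing i ρ → FirstMissing j ρ′ → toℕ j ≤ toℕ i
  firstMissing-antitone ρ′⊆ρ (e[i]∉ρ , _) (_ , below′) = ℕₚ.≮⇒≥ λ i<j → e[i]∉ρ (ρ′⊆ρ (below′ _ i<j))

  firstMissing-unique : ∀ {i j ρ} → FirstMissing i ρ → FirstMissing j ρ → i ≡ j
  firstMissing-unique mi mj =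
    Fₚ.toℕ-injective (ℕₚ.≤-antisym (firstMissing-antitone ⊆-refl mj mi) (firstMissing-antitone ⊆-refl mi mj))

record Enumeration {m} (P : Fin m → Set) : Set where
  field
    size          : ℕ
    at            : Fin size → Fin m
    at-sat        : ∀ i → P (at i)
    at-surjective : ∀ {y} → P y → ∃ λ i → at i ≡ y
    at-injective  : ∀ {i j} → at i ≡ at j → i ≡ j
open Enumeration

enumerate : ∀ {m} {P : Fin m → Set} → Decidable P → Enumeration P
enumerate {zero} P? = record
  { size = 0 ; at = λ () ; at-sat = λ ()
  ; at-surjective = λ {y} _ → ⊥-elim (Fₚ.¬Fin0 y) ; at-injective = λ {i} → ⊥-elim (Fₚ.¬Fin0 i) }
enumerate {suc m} {P} P? with enumerate (P? ∘ F.suc) | P? F.zero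
... | rest | no ¬p₀ = record
  { size = size rest ; at = F.suc ∘ at rest ; at-sat = at-sat rest
  ; at-surjective = surjective ; at-injective = at-injective rest ∘ Fₚ.suc-injective }
  where
  surjective : ∀ {y} → P y → ∃ λ i → F.suc (at rest i) ≡ y
  surjective {F.zero}  p₀ = ⊥-elim (¬p₀ p₀)
  surjective {F.suc y} py with at-surjective rest py
  ... | i , refl = i , refl
... | rest | yes p₀ = record
  { size = suc (size rest) ; at = at′ ; at-sat = sat ; at-surjective = surjective ; at-injective = injective }
  where
  at′ : Fin (suc (size rest)) → Fin (suc m)
  at′ F.zero    = F.zero
  at′ (F.suc i) = F.suc (at rest i)
  sat : ∀ i → P (at′ i)
  sat F.zero    = p₀
  sat (F.suc i) = at-sat rest i
  surjective : ∀ {y} → P y → ∃ λ i → at′ i ≡ y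
  surjective {F.zero}  _  = F.zero , refl
  surjective {F.suc y} py with at-surjective rest py
  ... | i , refl = F.suc i , refl
  injective : ∀ {i j} → at′ i ≡ at′ j → i ≡ j
  injective {F.zero}  {F.zero}  _  = refl
  injective {F.suc i} {F.suc j} eq = cong F.suc (at-injective rest (Fₚ.suc-injective eq))

module _ {m} {P Q : Fin m → Set} (e : Enumeration P) (f : Enumeration Q)
         (disjoint : ∀ {y} → P y → ¬ Q y) where

  private
    at⊎ : Fin (size e) ⊎ Fin (size f) → Fin m
    at⊎ = [ at e , at f ]′

    at⊎-injective : ∀ {s t} → at⊎ s ≡ at⊎ t → s ≡ t
    at⊎-injective {inj₁ i} {inj₁ j} eq = cong inj₁ (at-injective e eq)
    at⊎-injective {inj₂ i} {inj₂ j} eq = cong inj₂ (at-injective f eq)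
    at⊎-injective {inj₁ i} {inj₂ j} eq = ⊥-elim (disjoint (at-sat e i) (subst Q (sym eq) (at-sat f j)))
    at⊎-injective {inj₂ i} {inj₁ j} eq = ⊥-elim (disjoint (at-sat e j) (subst Q eq (at-sat f i)))

    splitAt-injective : ∀ {k l} → splitAt (size e) k ≡ splitAt (size e) l → k ≡ l
    splitAt-injective {k} {l} eq = begin
      k                                              ≡⟨ Fₚ.join-splitAt (size e) (size f) k ⟨
      F.join (size e) (size f) (splitAt (size e) k) ≡⟨ cong (F.join (size e) (size f)) eq ⟩
      F.join (size e) (size f) (splitAt (size e) l) ≡⟨ Fₚ.join-splitAt (size e) (size f) l ⟩
      l                                              ∎
      where open ≡-Reasoning

  append : Enumeration (λ y → P y ⊎ Q y)
  append = record
    { size = size e + size f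
    ; at = at⊎ ∘ splitAt (size e)
    ; at-sat = sat
    ; at-surjective = surjective
    ; at-injective = splitAt-injective ∘ at⊎-injective
    }
    where
    sat : ∀ k → P (at⊎ (splitAt (size e) k)) ⊎ Q (at⊎ (splitAt (size e) k))
    sat k with splitAt (size e) k
    ... | inj₁ i = inj₁ (at-sat e i)
    ... | inj₂ j = inj₂ (at-sat f j)
    surjective : ∀ {y} → P y ⊎ Q y → ∃ λ k → at⊎ (splitAt (size e) k) ≡ y
    surjective (inj₁ py) with at-surjective e py
    ... | i , refl = i ↑ˡ size f , cong at⊎ (Fₚ.splitAt-↑ˡ (size e) i (size f))
    surjective (inj₂ qy) with at-surjective f qy
    ... | j , refl = size e ↑ʳ j , cong at⊎ (Fₚ.splitAt-↑ʳ (size e) (size f) j)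

  append-ordered : ∀ {k l} → Q (at append k) → P (at append l) → toℕ l < toℕ k
  append-ordered {k} {l} qk pl with splitAt (size e) k in k≡ | splitAt (size e) l in l≡
  ... | inj₁ i | _      = ⊥-elim (disjoint (at-sat e i) qk)
  ... | inj₂ _ | inj₂ j = ⊥-elim (disjoint pl (at-sat f j))
  ... | inj₂ j | inj₁ i = begin-strict
    toℕ l              ≡⟨ cong toℕ (Fₚ.splitAt⁻¹-↑ˡ l≡) ⟨
    toℕ (i ↑ˡ size f)  ≡⟨ Fₚ.toℕ-↑ˡ i (size f) ⟩
    toℕ i              <⟨ ℕₚ.<-≤-trans (Fₚ.toℕ<n i) (ℕₚ.m≤m+n (size e) (toℕ j)) ⟩
    size e + toℕ j     ≡⟨ Fₚ.toℕ-↑ʳ (size e) j ⟨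
    toℕ (size e ↑ʳ j)  ≡⟨ cong toℕ (Fₚ.splitAt⁻¹-↑ʳ k≡) ⟩
    toℕ k              ∎
    where open ℕₚ.≤-Reasoning

InInterval : Tile n → Subset n → Set
InInterval t ρ = least t ⊆ ρ × ρ ⊆ simplex t × Nonempty ρ × (kind t ≡ critical → ρ ≢ least t)

inTile⇔inInterval : ∀ {t : Tile n} {ρ} → InTile t ρ ⇔ InInterval t ρ
inTile⇔inInterval {t = t} {ρ} = mk⇔
  (λ (ρ⊆σ , ρ≢∅ , ρ⊈facets , ρ≢least) →
     (λ {x} x∈least → decidable-stable (x ∈? ρ) λ x∉ρ →
        ρ⊈facets x x∈least (from p⊆q-x⇔p⊆q∧x∉p (ρ⊆σ , x∉ρ)))
     , ρ⊆σ , ρ≢∅ , ρ≢least)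
  (λ (least⊆ρ , ρ⊆σ , ρ≢∅ , ρ≢least) →
     ρ⊆σ , ρ≢∅ , (λ x x∈least ρ⊆σ-x → x∉p-x (simplex t) (ρ⊆σ-x (least⊆ρ x∈least))) , ρ≢least)

inInterval-upward : ∀ {t : Tile n} {ρ ρ′} → InInterval t ρ → ρ ⊆ ρ′ → ρ′ ⊆ simplex t → InInterval t ρ′
inInterval-upward (least⊆ρ , _ , (x , x∈ρ) , ρ≢least) ρ⊆ρ′ ρ′⊆σ =
  ⊆-trans least⊆ρ ρ⊆ρ′ , ρ′⊆σ , (x , ρ⊆ρ′ x∈ρ) ,
  λ { isCritical refl → ρ≢least isCritical (⊆-antisym ρ⊆ρ′ least⊆ρ) }

critical? : (k : Kind) → Dec (k ≡ critical)
critical? basic    = no λ ()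
critical? critical = yes refl

inInterval? : (t : Tile n) (ρ : Subset n) → Dec (InInterval t ρ)
inInterval? t ρ = least t ⊆? ρ ×-dec ρ ⊆? simplex t ×-dec nonempty? ρ
                  ×-dec (critical? (kind t) →-dec ¬? (ρ ≟ₛ least t))

kindOf : {P : Set} → Dec P → Kind
kindOf (yes _) = critical
kindOf (no  _) = basic

kindOf≡critical⇔ : {P : Set} (P? : Dec P) → kindOf P? ≡ critical ⇔ P
kindOf≡critical⇔ (yes p) = mk⇔ (λ _ → p) (λ _ → refl)
kindOf≡critical⇔ (no ¬p) = mk⇔ (λ ()) (λ p → ⊥-elim (¬p p))

openSimplex : (s : Subset n) → Nonempty s → Tile n
openSimplex s s≢∅ = record
  { simplex = s ; least = s ; kind = basic ; nonempty = s≢∅ ; least⊆ = ⊆-refl ; crit-ok = λ () }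

topCritical : (s : Subset n) {v : Fin n} → v ∈ s → Tile n
topCritical s {v} v∈s = record
  { simplex = s ; least = s - v ; kind = critical ; nonempty = v , v∈s ; least⊆ = x∈p-y⇒x∈p s
  ; crit-ok = λ _ s-v≡s → x∉p-x s (subst (v ∈_) (sym s-v≡s) v∈s) }

IsOpen : Tile n → Set
IsOpen t = ∀ ρ → InTile t ρ ⇔ ρ ≡ simplex t

least≡simplex⇒isOpen : ∀ {t : Tile n} → least t ≡ simplex t → IsOpen t
least≡simplex⇒isOpen {t = t} least≡σ ρ = mk⇔
  (λ inT → let (least⊆ρ , ρ⊆σ , _) = to (inTile⇔inInterval {t = t}) inT
           in ⊆-antisym ρ⊆σ (subst (_⊆ ρ) least≡σ least⊆ρ))
  (λ { refl → from (inTile⇔inInterval {t = t})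
         (least⊆ t , ⊆-refl , nonempty t , λ isCritical σ≡least → crit-ok t isCritical (sym σ≡least)) })

critical-facet⇒isOpen : ∀ {t : Tile n} {v} → kind t ≡ critical → least t ≡ simplex t - v → v ∈ simplex t → IsOpen t
critical-facet⇒isOpen {t = t} {v} isCritical least≡σ-v v∈σ ρ = mk⇔ to′
  (λ { refl → from (inTile⇔inInterval {t = t})
         (least⊆ t , ⊆-refl , nonempty t ,
          λ _ σ≡least → x∉p-x (simplex t) (subst (v ∈_) (trans σ≡least least≡σ-v) v∈σ)) })
  where
  to′ : InTile t ρ → ρ ≡ simplex t
  to′ ρ∈t with to (inTile⇔inInterval {t = t}) ρ∈t | v ∈? ρ
  ... | least⊆ρ , ρ⊆σ , _ , _ | yes v∈ρ =
    ⊆-antisym ρ⊆σ (p-x⊆q⇒p⊆q v∈ρ (subst (_⊆ ρ) least≡σ-v least⊆ρ))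
  ... | least⊆ρ , ρ⊆σ , _ , ρ≢least | no v∉ρ = ⊥-elim (ρ≢least isCritical (begin
    ρ             ≡⟨ ⊆-antisym (from p⊆q-x⇔p⊆q∧x∉p (ρ⊆σ , v∉ρ)) (subst (_⊆ ρ) least≡σ-v least⊆ρ) ⟩
    simplex t - v ≡⟨ least≡σ-v ⟨
    least t       ∎))
    where open ≡-Reasoning

morseFace≡least : ∀ (t : Tile n) → kind t ≡ critical →
                  1 ≤ ∣ least t ∣ → ∣ least t ∣ + 2 ≤ ∣ simplex t ∣ → morseFace t ≡ least t
morseFace≡least t t-crit 1≤∣κ∣ big with kind t | 1 ℕₚ.≤? ∣ least t ∣ | ∣ least t ∣ + 2 ℕₚ.≤? ∣ simplex t ∣
morseFace≡least t ()     _     _   | basic    | _        | _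
... | critical | yes _    | yes _    = refl
... | critical | no  ¬1≤  | _        = ⊥-elim (¬1≤ 1≤∣κ∣)
... | critical | yes _    | no  ¬big = ⊥-elim (¬big big)

least≡facet : ∀ (t : Tile n) → kind t ≡ critical → ¬ (∣ least t ∣ + 2 ≤ ∣ simplex t ∣) →
              ∃ λ v → v ∈ simplex t × least t ≡ simplex t - v
least≡facet t t-crit small with ⊈⇒∃∉ (λ σ⊆κ → crit-ok t t-crit (⊆-antisym (least⊆ t) σ⊆κ))
... | v , v∈σ , v∉κ = v , v∈σ , p⊆q∧∣q∣≤∣p∣⇒p≡q (from p⊆q-x⇔p⊆q∧x∉p (least⊆ t , v∉κ)) ∣σ-v∣≤∣κ∣
  where
  ∣σ-v∣≤∣κ∣ : ∣ simplex t - v ∣ ≤ ∣ least t ∣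
  ∣σ-v∣≤∣κ∣ = ℕₚ.≤-pred (begin
    suc ∣ simplex t - v ∣ ≡⟨ suc∣p-x∣≡∣p∣ (simplex t) v∈σ ⟩
    ∣ simplex t ∣         ≤⟨ ℕₚ.≤-pred (subst (suc ∣ simplex t ∣ ≤_) (ℕₚ.+-comm ∣ least t ∣ 2) (ℕₚ.≰⇒> small)) ⟩
    suc ∣ least t ∣       ∎)
    where open ℕₚ.≤-Reasoning

module _ {τ : Subset n} {L L′ : Cx n} where

  st-mono : (∀ {ρ} → L ρ → L′ ρ) → ∀ F → st τ L F → st τ L′ F
  st-mono L⇒L′ (false ∷ ρ) (Lρ , τ⊈ρ)    = L⇒L′ Lρ , τ⊈ρ
  st-mono L⇒L′ (true  ∷ ρ) (s , Ls , cone) = s , L⇒L′ Ls , cone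

  lift-mono : (∀ {ρ} → L ρ → L′ ρ) → ∀ F → lift L F → lift L′ F
  lift-mono L⇒L′ (false ∷ ρ) Lρ = L⇒L′ Lρ

  stSub-resp : (∀ ρ → L ρ ⇔ L′ ρ) → ∀ F → stSub τ L F → stSub τ L′ F
  stSub-resp L⇔L′ F (inj₁ (Lτ , stF))    = inj₁ (to (L⇔L′ τ) Lτ , st-mono (to (L⇔L′ _)) F stF)
  stSub-resp L⇔L′ F (inj₂ (L∌τ , liftF)) = inj₂ (L∌τ ∘ from (L⇔L′ τ) , lift-mono (to (L⇔L′ _)) F liftF)

module _ {m N} {K L L′ : Cx m} {ts ts′ : Fin N → Tile m}
         (L⇔L′ : ∀ ρ → L ρ ⇔ L′ ρ)
         (simplex≡ : ∀ i → simplex (ts i) ≡ simplex (ts′ i))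
         (inTile⇔ : ∀ i ρ → InTile (ts i) ρ ⇔ InTile (ts′ i) ρ) where

  private
    relFace⇔ : ∀ {ρ} → RelFace K L ρ ⇔ RelFace K L′ ρ
    relFace⇔ {ρ} = mk⇔ (λ (Kρ , L∌ρ) → Kρ , L∌ρ ∘ from (L⇔L′ ρ))
                       (λ (Kρ , L′∌ρ) → Kρ , L′∌ρ ∘ to (L⇔L′ ρ))

    closedUnion-resp : ∀ {P P′ : Fin N → Set} → (∀ i → P i ⇔ P′ i) →
                       ClosedUnion K L ts P → ClosedUnion K L′ ts′ P′
    closedUnion-resp P⇔P′ closed i P′i ρ ρ∈ti ρ′ ρ′⊆ρ ρ′∈K∖L′
      with closed i (from (P⇔P′ i) P′i) ρ (from (inTile⇔ i ρ) ρ∈ti) ρ′ ρ′⊆ρ (from relFace⇔ ρ′∈K∖L′)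
    ... | j , Pj , ρ′∈tj = j , to (P⇔P′ j) Pj , to (inTile⇔ j ρ′) ρ′∈tj

  isShellableTiling-resp : IsShellableTiling K L ts → IsShellableTiling K L′ ts′
  isShellableTiling-resp (tiling , shelling) =
    record
      { underlying-in = λ i → subst K (simplex≡ i) (underlying-in i)
      ; sub = λ i ρ ρ∈ti → to relFace⇔ (sub i ρ (from (inTile⇔ i ρ) ρ∈ti))
      ; cover-unique = cover
      ; dim-closed = λ d → closedUnion-resp (dim⇔ d) (dim-closed d)
      } ,
    λ p → closedUnion-resp (λ _ → ⇔-refl) (shelling p)
    where
    open IsTiling tiling
    cover : ∀ ρ → RelFace K L′ ρ → Σ (Fin N) λ i → InTile (ts′ i) ρ × (∀ j → InTile (ts′ j) ρ → j ≡ i)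
    cover ρ ρ∈K∖L′ with cover-unique ρ (from relFace⇔ ρ∈K∖L′)
    ... | i , ρ∈ti , unique = i , to (inTile⇔ i ρ) ρ∈ti , λ j ρ∈tj → unique j (from (inTile⇔ j ρ) ρ∈tj)
    dim⇔ : ∀ d i → d < dim (ts i) ⇔ d < dim (ts′ i)
    dim⇔ d i = mk⇔ (subst (d <_) dim≡) (subst (d <_) (sym dim≡))
      where dim≡ = cong (λ s → ∣ s ∣ ∸ 1) (simplex≡ i)

module StellarSubdivision {m} (T : Tile m) (τ : Subset m) (τ⊆σ : τ ⊆ simplex T) (τ≢∅ : Nonempty τ) where

  σ κ : Subset m
  σ = simplex T
  κ = least T

  K L : Cx (suc m)
  K = st τ (closure σ)
  L = stSub τ (removed T)

  private
    τ∩κ : Enumeration (λ y → y ∈ τ × y ∈ κ)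
    τ∩κ = enumerate λ y → y ∈? τ ×-dec y ∈? κ

    τ∖κ : Enumeration (λ y → y ∈ τ × y ∉ κ)
    τ∖κ = enumerate λ y → y ∈? τ ×-dec ¬? (y ∈? κ)

    disjoint : ∀ {y} → y ∈ τ × y ∈ κ → ¬ (y ∈ τ × y ∉ κ)
    disjoint (_ , y∈κ) (_ , y∉κ) = y∉κ y∈κ

    τ-enumeration : Enumeration (λ y → (y ∈ τ × y ∈ κ) ⊎ (y ∈ τ × y ∉ κ))
    τ-enumeration = append τ∩κ τ∖κ disjoint

  N : ℕ
  N = size τ-enumeration

  e : Fin N → Fin m
  e = at τ-enumeration

  e-∈τ : ∀ i → e i ∈ τ
  e-∈τ i = [ proj₁ , proj₁ ]′ (at-sat τ-enumeration i)

  e-∈σ : ∀ i → e i ∈ σ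
  e-∈σ i = τ⊆σ (e-∈τ i)

  e-surjective : ∀ {y} → y ∈ τ → ∃ λ i → e i ≡ y
  e-surjective {y} y∈τ with y ∈? κ
  ... | yes y∈κ = at-surjective τ-enumeration (inj₁ (y∈τ , y∈κ))
  ... | no  y∉κ = at-surjective τ-enumeration (inj₂ (y∈τ , y∉κ))

  e-injective : ∀ {i j} → e i ≡ e j → i ≡ j
  e-injective = at-injective τ-enumeration

  e-κ-first : ∀ {i j} → e i ∉ κ → e j ∈ κ → toℕ j < toℕ i
  e-κ-first {i} {j} e[i]∉κ e[j]∈κ = append-ordered τ∩κ τ∖κ disjoint (e-∈τ i , e[i]∉κ) (e-∈τ j , e[j]∈κ)

  -- true ∷ ρ is the cone τ̂ * ρ; it lies in the subdivided relative complex exactly when ρ ∪ τ is a face of T.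
  SubdivFace : Subset (suc m) → Set
  SubdivFace (false ∷ ρ) = InInterval T ρ × ¬ τ ⊆ ρ
  SubdivFace (true  ∷ ρ) = ρ ⊆ σ × InInterval T (ρ ∪ τ) × ¬ τ ⊆ ρ

  subdivFace⇒τ⊈ : ∀ c ρ → SubdivFace (c ∷ ρ) → ¬ τ ⊆ ρ
  subdivFace⇒τ⊈ false ρ (_ , τ⊈ρ)     = τ⊈ρ
  subdivFace⇒τ⊈ true  ρ (_ , _ , τ⊈ρ) = τ⊈ρ

  private
    inT⇔ : ∀ {ρ} → InTile T ρ ⇔ InInterval T ρ
    inT⇔ = inTile⇔inInterval {t = T}

    τ∈σ̄ : closure σ τ
    τ∈σ̄ = τ⊆σ , τ≢∅

    removed⇒∈L : ∀ {ρ} → removed T ρ → ¬ τ ⊆ ρ → L (false ∷ ρ)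
    removed⇒∈L ρ-removed τ⊈ρ with inInterval? T τ
    ... | yes τ∈T = inj₂ ((λ (_ , τ∉T) → τ∉T (from inT⇔ τ∈T)) , ρ-removed)
    ... | no  τ∉T = inj₁ ((τ∈σ̄ , τ∉T ∘ to inT⇔) , ρ-removed , τ⊈ρ)

    cone∉L⇒ρ∪τ∈T : ∀ {ρ} → ρ ⊆ σ → ¬ τ ⊆ ρ → ¬ L (true ∷ ρ) → InInterval T (ρ ∪ τ)
    cone∉L⇒ρ∪τ∈T {ρ} ρ⊆σ τ⊈ρ cone∉L with inInterval? T τ
    ... | yes τ∈T = inInterval-upward {t = T} τ∈T (q⊆p∪q ρ τ) (∪-⊆ ρ⊆σ τ⊆σ)
    ... | no  τ∉T = decidable-stable (inInterval? T (ρ ∪ τ)) λ ρ∪τ∉T →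
      cone∉L (inj₁ ((τ∈σ̄ , τ∉T ∘ to inT⇔) , ρ ∪ τ , (ρ∪τ∈σ̄ , ρ∪τ∉T ∘ to inT⇔) , q⊆p∪q ρ τ , p⊆p∪q τ , τ⊈ρ))
      where
      ρ∪τ∈σ̄ : closure σ (ρ ∪ τ)
      ρ∪τ∈σ̄ = ∪-⊆ ρ⊆σ τ⊆σ , (proj₁ τ≢∅ , q⊆p∪q ρ τ (proj₂ τ≢∅))

  relFace⇔subdivFace : ∀ F → RelFace K L F ⇔ SubdivFace F
  relFace⇔subdivFace (false ∷ ρ) = mk⇔
    (λ ((ρ∈σ̄ , τ⊈ρ) , ρ∉L) →
       decidable-stable (inInterval? T ρ) (λ ρ∉T → ρ∉L (removed⇒∈L (ρ∈σ̄ , ρ∉T ∘ to inT⇔) τ⊈ρ)) , τ⊈ρ)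
    (λ (ρ∈T@(_ , ρ⊆σ , ρ≢∅ , _) , τ⊈ρ) →
       ((ρ⊆σ , ρ≢∅) , τ⊈ρ) , λ where
         (inj₁ (_ , (_ , ρ∉T) , _)) → ρ∉T (from inT⇔ ρ∈T)
         (inj₂ (_ , (_ , ρ∉T)))     → ρ∉T (from inT⇔ ρ∈T))
  relFace⇔subdivFace (true ∷ ρ) = mk⇔
    (λ ((s , (s⊆σ , _) , _ , ρ⊆s , τ⊈ρ) , cone∉L) →
       let ρ⊆σ = ⊆-trans ρ⊆s s⊆σ in ρ⊆σ , cone∉L⇒ρ∪τ∈T ρ⊆σ τ⊈ρ cone∉L , τ⊈ρ)
    (λ (ρ⊆σ , ρ∪τ∈T , τ⊈ρ) →
       (σ , (⊆-refl , nonempty T) , τ⊆σ , ρ⊆σ , τ⊈ρ) , λ where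
         (inj₁ (_ , s , ((s⊆σ , _) , s∉T) , τ⊆s , ρ⊆s , _)) →
           s∉T (from inT⇔ (inInterval-upward {t = T} ρ∪τ∈T (∪-⊆ ρ⊆s τ⊆s) s⊆σ))
         (inj₂ (_ , ())))

  module _ (ts : Fin N → Tile (suc m))
           (simplex-ts : ∀ i → simplex (ts i) ≡ true ∷ (σ - e i))
           (faces-ts : ∀ i c ρ → InInterval (ts i) (c ∷ ρ) ⇔ (FirstMissing e i ρ × SubdivFace (c ∷ ρ)))
           where

    private
      inTs⇔ : ∀ i c ρ → InTile (ts i) (c ∷ ρ) ⇔ (FirstMissing e i ρ × SubdivFace (c ∷ ρ))
      inTs⇔ i c ρ = ⇔-trans (inTile⇔inInterval {t = ts i}) (faces-ts i c ρ)

      dim-ts : ∀ i → dim (ts i) ≡ ∣ σ ∣ ∸ 1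
      dim-ts i rewrite simplex-ts i = cong (_∸ 1) (suc∣p-x∣≡∣p∣ σ (e-∈σ i))

      tile-of : ∀ F → RelFace K L F → Σ (Fin N) λ i → InTile (ts i) F
      tile-of (c ∷ ρ) F∈K∖L with to (relFace⇔subdivFace (c ∷ ρ)) F∈K∖L
      ... | F∈st with ⊈⇒∃∉ (subdivFace⇒τ⊈ c ρ F∈st)
      ... | y , y∈τ , y∉ρ with e-surjective y∈τ
      ... | k , refl with firstMissing-exists e y∉ρ
      ... | i , i-first = i , from (inTs⇔ i c ρ) (i-first , F∈st)

      earlier-tile : ∀ i F → InTile (ts i) F → ∀ F′ → F′ ⊆ F → RelFace K L F′ →
                     Σ (Fin N) λ j → toℕ j ≤ toℕ i × InTile (ts j) F′
      earlier-tile i (c ∷ ρ) F∈ti F′@(c′ ∷ ρ′) F′⊆F F′∈K∖L with tile-of F′ F′∈K∖L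
      ... | j , F′∈tj = j , firstMissing-antitone e (drop-∷-⊆ F′⊆F)
                              (proj₁ (to (inTs⇔ i c ρ) F∈ti)) (proj₁ (to (inTs⇔ j c′ ρ′) F′∈tj)) , F′∈tj

      tiling : IsTiling K L ts
      tiling = record
        { underlying-in = λ i → subst K (sym (simplex-ts i))
            (σ , (⊆-refl , nonempty T) , τ⊆σ , x∈p-y⇒x∈p σ , λ τ⊆σ-e → x∉p-x σ (τ⊆σ-e (e-∈τ i)))
        ; sub = λ { i (c ∷ ρ) F∈ti → from (relFace⇔subdivFace (c ∷ ρ)) (proj₂ (to (inTs⇔ i c ρ) F∈ti)) }
        ; cover-unique = λ F F∈K∖L → let (i , F∈ti) = tile-of F F∈K∖L in i , F∈ti , unique F F∈ti
        ; dim-closed = λ d i d<dim F F∈ti F′ F′⊆F F′∈K∖L →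
            let (j , _ , F′∈tj) = earlier-tile i F F∈ti F′ F′⊆F F′∈K∖L
            in j , subst (d <_) (trans (dim-ts i) (sym (dim-ts j))) d<dim , F′∈tj
        }
        where
        unique : ∀ {i} F → InTile (ts i) F → ∀ j → InTile (ts j) F → j ≡ i
        unique {i} (c ∷ ρ) F∈ti j F∈tj =
          firstMissing-unique e (proj₁ (to (inTs⇔ j c ρ) F∈tj)) (proj₁ (to (inTs⇔ i c ρ) F∈ti))

    shellable-by-firstMissing : IsShellableTiling K L ts
    shellable-by-firstMissing = tiling , λ p i i<p F F∈ti F′ F′⊆F F′∈K∖L →
      let (j , j≤i , F′∈tj) = earlier-tile i F F∈ti F′ F′⊆F F′∈K∖L
      in j , ℕₚ.≤-<-trans j≤i i<p , F′∈tj

module ConeTiles {m} (T : Tile m) (τ : Subset m) (τ⊆σ : τ ⊆ simplex T) (τ≢∅ : Nonempty τ)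
                 (τ⊈κ : kind T ≡ critical → ¬ τ ⊆ least T) where

  open StellarSubdivision T τ τ⊆σ τ≢∅ public

  Precedes : Fin N → Fin m → Set
  Precedes i y = ∃ λ j → toℕ j < toℕ i × e j ≡ y

  precedes? : ∀ i y → Dec (Precedes i y)
  precedes? i y = Fₚ.any? λ j → toℕ j ℕₚ.<? toℕ i ×-dec e j Fₚ.≟ y

  prefix : Fin N → Subset m
  prefix i = subsetOf (precedes? i)

  prefix⊆⇔ : ∀ {i ρ} → prefix i ⊆ ρ ⇔ (∀ j → toℕ j < toℕ i → e j ∈ ρ)
  prefix⊆⇔ {i} {ρ} = mk⇔ (λ prefix⊆ρ j j<i → prefix⊆ρ (∈-subsetOf⁺ (precedes? i) (j , j<i , refl))) prefix⊆
    where
    prefix⊆ : (∀ j → toℕ j < toℕ i → e j ∈ ρ) → prefix i ⊆ ρ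
    prefix⊆ before y∈prefix with ∈-subsetOf⁻ (precedes? i) y∈prefix
    ... | j , j<i , refl = before j j<i

  base : Fin N → Subset m
  base i = (κ ─ τ) ∪ prefix i

  base⊆⇔ : ∀ {i ρ} → base i ⊆ ρ ⇔ (κ ─ τ ⊆ ρ × ∀ j → toℕ j < toℕ i → e j ∈ ρ)
  base⊆⇔ {i} {ρ} = mk⇔ split (λ (κ∖τ⊆ρ , before) → ∪-⊆ κ∖τ⊆ρ (from prefix⊆⇔ before))
    where
    split : base i ⊆ ρ → κ ─ τ ⊆ ρ × (∀ j → toℕ j < toℕ i → e j ∈ ρ)
    split base⊆ρ = ⊆-trans (p⊆p∪q (prefix i)) base⊆ρ , to prefix⊆⇔ (⊆-trans (q⊆p∪q (κ ─ τ) (prefix i)) base⊆ρ)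

  κ⊆base : ∀ {i} → e i ∉ κ → κ ⊆ base i
  κ⊆base {i} e[i]∉κ {y} y∈κ with y ∈? τ
  ... | no  y∉τ = p⊆p∪q (prefix i) (x∈p∧x∉q⇒x∈p─q y∈κ y∉τ)
  ... | yes y∈τ with e-surjective y∈τ
  ... | j , refl = q⊆p∪q (κ ─ τ) (prefix i) (∈-subsetOf⁺ (precedes? i) (j , e-κ-first e[i]∉κ y∈κ , refl))

  base⊆σ-e : ∀ i → base i ⊆ σ - e i
  base⊆σ-e i = from p⊆q-x⇔p⊆q∧x∉p
    ( ∪-⊆ (⊆-trans (p─q⊆p κ τ) (least⊆ T)) (from prefix⊆⇔ λ j _ → e-∈σ j)
    , λ e[i]∈base → [ (λ e[i]∈κ∖τ → x∈p─q⇒x∉q κ τ e[i]∈κ∖τ (e-∈τ i))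
                    , (λ e[i]∈prefix → let (j , j<i , e[j]≡e[i]) = ∈-subsetOf⁻ (precedes? i) e[i]∈prefix
                                       in ℕₚ.<-irrefl (cong toℕ (e-injective e[j]≡e[i])) j<i) ]′
                    (x∈p∪q⁻ (κ ─ τ) (prefix i) e[i]∈base))

  coneLeast : Fin N → Subset (suc m)
  coneLeast i = does (e i ∈? κ) ∷ base i

  coneLeast⊆⇔ : ∀ {i c ρ} → coneLeast i ⊆ c ∷ ρ ⇔ ((e i ∈ κ → c ≡ true) × base i ⊆ ρ)
  coneLeast⊆⇔ {i} = ⇔-trans ∷⊆∷⇔ (mk⇔ (map₁ (head-to (e i ∈? κ))) (map₁ (head-from (e i ∈? κ))))
    where
    head-to : ∀ {c} (e[i]∈?κ : Dec (e i ∈ κ)) → (does e[i]∈?κ ≡ true → c ≡ true) → e i ∈ κ → c ≡ true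
    head-to (yes _)      c≡true _      = c≡true refl
    head-to (no  e[i]∉κ) _      e[i]∈κ = ⊥-elim (e[i]∉κ e[i]∈κ)
    head-from : ∀ {c} (e[i]∈?κ : Dec (e i ∈ κ)) → (e i ∈ κ → c ≡ true) → does e[i]∈?κ ≡ true → c ≡ true
    head-from (yes e[i]∈κ) c≡true _ = c≡true e[i]∈κ

  IsCritical : Fin N → Set
  IsCritical i = kind T ≡ critical × coneLeast i ≡ false ∷ κ

  isCritical? : ∀ i → Dec (IsCritical i)
  isCritical? i = critical? (kind T) ×-dec coneLeast i ≟ₛ (false ∷ κ)

  isCritical⇔ : ∀ {i} → IsCritical i ⇔ (kind T ≡ critical × FirstMissing e i κ)
  isCritical⇔ {i} = mk⇔
    (λ (T-crit , coneLeast≡) →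
       let e[i]∉κ = λ e[i]∈κ → true≢false (trans (sym (dec-true (e i ∈? κ) e[i]∈κ)) (Vecₚ.∷-injectiveˡ coneLeast≡))
       in T-crit , e[i]∉κ , proj₂ (to base⊆⇔ (⊆-reflexive (Vecₚ.∷-injectiveʳ coneLeast≡))))
    (λ (T-crit , e[i]∉κ , before) →
       T-crit , cong₂ _∷_ (dec-false (e i ∈? κ) e[i]∉κ) (⊆-antisym (from base⊆⇔ (p─q⊆p κ τ , before)) (κ⊆base e[i]∉κ)))

  tile : Fin N → Tile (suc m)
  tile i = record
    { simplex  = true ∷ (σ - e i)
    ; least    = coneLeast i
    ; kind     = kindOf (isCritical? i)
    ; nonempty = F.zero , here
    ; least⊆   = from ∷⊆∷⇔ ((λ _ → refl) , base⊆σ-e i)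
    ; crit-ok  = λ crit coneLeast≡simplex →
        true≢false (trans (sym (Vecₚ.∷-injectiveˡ coneLeast≡simplex))
                          (Vecₚ.∷-injectiveˡ (proj₂ (to (kindOf≡critical⇔ (isCritical? i)) crit))))
    }

  private
    ⊆cone⇔ : ∀ {i c ρ} → (c ∷ ρ) ⊆ (true ∷ (σ - e i)) ⇔ (ρ ⊆ σ × e i ∉ ρ)
    ⊆cone⇔ = ⇔-trans ∷⊆∷⇔ (mk⇔ (to p⊆q-x⇔p⊆q∧x∉p ∘ proj₂) (λ ρ⊆σ-e → (λ _ → refl) , from p⊆q-x⇔p⊆q∧x∉p ρ⊆σ-e))

    κ∖τ⊆ρ⇒ρ∪τ∈T : ∀ {ρ} → ρ ⊆ σ → κ ─ τ ⊆ ρ → InInterval T (ρ ∪ τ)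
    κ∖τ⊆ρ⇒ρ∪τ∈T {ρ} ρ⊆σ κ∖τ⊆ρ =
      to p─q⊆r⇔p⊆r∪q κ∖τ⊆ρ , ∪-⊆ ρ⊆σ τ⊆σ , (proj₁ τ≢∅ , q⊆p∪q ρ τ (proj₂ τ≢∅)) ,
      λ T-crit ρ∪τ≡κ → τ⊈κ T-crit (subst (τ ⊆_) ρ∪τ≡κ (q⊆p∪q ρ τ))

    tile-face⇒ : ∀ i c ρ → InInterval (tile i) (c ∷ ρ) → FirstMissing e i ρ × SubdivFace (c ∷ ρ)
    tile-face⇒ i false ρ (coneLeast⊆ , ⊆cone , ρ≢∅ , no-crit) =
      let (ρ⊆σ , e[i]∉ρ) = to ⊆cone⇔ ⊆cone
          (head , base⊆ρ) = to coneLeast⊆⇔ coneLeast⊆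
          (_ , before) = to base⊆⇔ base⊆ρ
          e[i]∉κ = λ e[i]∈κ → true≢false (sym (head e[i]∈κ))
          τ⊈ρ = λ τ⊆ρ → e[i]∉ρ (τ⊆ρ (e-∈τ i))
          ρ≢κ = λ T-crit ρ≡κ →
            let isCrit = from isCritical⇔ (T-crit , e[i]∉κ , λ j j<i → subst (e j ∈_) ρ≡κ (before j j<i))
            in no-crit (from (kindOf≡critical⇔ (isCritical? i)) isCrit) (trans (cong (false ∷_) ρ≡κ) (sym (proj₂ isCrit)))
      in (e[i]∉ρ , before) , (⊆-trans (κ⊆base e[i]∉κ) base⊆ρ , ρ⊆σ , nonempty-∷⁻ ρ≢∅ , ρ≢κ) , τ⊈ρ
    tile-face⇒ i true ρ (coneLeast⊆ , ⊆cone , _ , _) =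
      let (ρ⊆σ , e[i]∉ρ) = to ⊆cone⇔ ⊆cone
          (κ∖τ⊆ρ , before) = to base⊆⇔ (proj₂ (to coneLeast⊆⇔ coneLeast⊆))
      in (e[i]∉ρ , before) , ρ⊆σ , κ∖τ⊆ρ⇒ρ∪τ∈T ρ⊆σ κ∖τ⊆ρ , λ τ⊆ρ → e[i]∉ρ (τ⊆ρ (e-∈τ i))

    tile-face⇐ : ∀ i c ρ → FirstMissing e i ρ × SubdivFace (c ∷ ρ) → InInterval (tile i) (c ∷ ρ)
    tile-face⇐ i false ρ ((e[i]∉ρ , before) , (κ⊆ρ , ρ⊆σ , (x , x∈ρ) , T-crit⇒ρ≢κ) , _) =
      from coneLeast⊆⇔ ((λ e[i]∈κ → ⊥-elim (e[i]∉ρ (κ⊆ρ e[i]∈κ))) , from base⊆⇔ (⊆-trans (p─q⊆p κ τ) κ⊆ρ , before)) ,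
      from ⊆cone⇔ (ρ⊆σ , e[i]∉ρ) , (F.suc x , there x∈ρ) ,
      λ crit false∷ρ≡coneLeast →
        let (T-crit , coneLeast≡) = to (kindOf≡critical⇔ (isCritical? i)) crit
        in T-crit⇒ρ≢κ T-crit (Vecₚ.∷-injectiveʳ (trans false∷ρ≡coneLeast coneLeast≡))
    tile-face⇐ i true ρ ((e[i]∉ρ , before) , (ρ⊆σ , (κ⊆ρ∪τ , _) , _)) =
      from coneLeast⊆⇔ ((λ _ → refl) , from base⊆⇔ (from p─q⊆r⇔p⊆r∪q κ⊆ρ∪τ , before)) ,
      from ⊆cone⇔ (ρ⊆σ , e[i]∉ρ) , (F.zero , here) ,
      λ crit true∷ρ≡coneLeast →
        true≢false (Vecₚ.∷-injectiveˡ (trans true∷ρ≡coneLeast (proj₂ (to (kindOf≡critical⇔ (isCritical? i)) crit))))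

  shellable : IsShellableTiling K L tile
  shellable = shellable-by-firstMissing tile (λ _ → refl) λ i c ρ → mk⇔ (tile-face⇒ i c ρ) (tile-face⇐ i c ρ)

  kind-tile≡critical⇔ : ∀ {i} → kind (tile i) ≡ critical ⇔ (kind T ≡ critical × FirstMissing e i κ)
  kind-tile≡critical⇔ {i} = ⇔-trans (kindOf≡critical⇔ (isCritical? i)) isCritical⇔

  unique-critical-tile : kind T ≡ critical →
    Σ (Fin N) λ i → kind (tile i) ≡ critical × order (tile i) ≡ order T × (∀ j → kind (tile j) ≡ critical → j ≡ i)
  unique-critical-tile T-crit with ⊈⇒∃∉ (τ⊈κ T-crit)
  ... | y , y∈τ , y∉κ with e-surjective y∈τ
  ... | k , refl with firstMissing-exists e y∉κ
  ... | i , i-first =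
    i , from kind-tile≡critical⇔ (T-crit , i-first) ,
    cong ∣_∣ (proj₂ (from isCritical⇔ (T-crit , i-first))) ,
    λ j j-crit → firstMissing-unique e (proj₂ (to kind-tile≡critical⇔ j-crit)) i-first

SubdivisionHTiling : ∀ {m} → Tile m → Subset m → Set
SubdivisionHTiling {m} T τ =
  Σ ℕ λ N → Σ (Fin N → Tile (suc m)) λ ts →
    IsShellableTiling (st τ (closure (simplex T))) (stSub τ (removed T)) ts
    × ((Σ (Fin N) λ i → kind (ts i) ≡ critical) → kind T ≡ critical)
    × (kind T ≡ critical →
        Σ (Fin N) λ i → kind (ts i) ≡ critical × order (ts i) ≡ order T
          × (∀ j → kind (ts j) ≡ critical → j ≡ i))

coneHTiling : ∀ {m} (T : Tile m) (τ : Subset m) → τ ⊆ simplex T → Nonempty τ →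
              (kind T ≡ critical → ¬ τ ⊆ least T) → SubdivisionHTiling T τ
coneHTiling T τ τ⊆σ τ≢∅ τ⊈κ =
  N , tile , shellable , (λ (_ , crit) → proj₁ (to kind-tile≡critical⇔ crit)) , unique-critical-tile
  where open ConeTiles T τ τ⊆σ τ≢∅ τ⊈κ

module CriticalOpenSimplex {m} (T : Tile m) (τ : Subset m) (τ⊆σ : τ ⊆ simplex T) (τ≢∅ : Nonempty τ)
  (T-crit : kind T ≡ critical) {v} (v∈σ : v ∈ simplex T) (κ≡σ-v : least T ≡ simplex T - v) where

  open ConeTiles (openSimplex (simplex T) (nonempty T)) τ τ⊆σ τ≢∅ (λ ())

  last : Fin N
  last = proj₁ (greatest (proj₁ (e-surjective (proj₂ τ≢∅))))

  last-greatest : ∀ (j : Fin N) → toℕ j ≤ toℕ last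
  last-greatest = proj₂ (greatest (proj₁ (e-surjective (proj₂ τ≢∅))))

  coneLeast-last : coneLeast last ≡ true ∷ (σ - e last)
  coneLeast-last = cong₂ _∷_ (dec-true (e last ∈? σ) (e-∈σ last)) (⊆-antisym (base⊆σ-e last) σ-e⊆base)
    where
    σ-e⊆base : σ - e last ⊆ base last
    σ-e⊆base {y} y∈σ-e with y ∈? τ
    ... | no  y∉τ = p⊆p∪q (prefix last) (x∈p∧x∉q⇒x∈p─q (x∈p-y⇒x∈p σ y∈σ-e) y∉τ)
    ... | yes y∈τ with e-surjective y∈τ
    ... | j , refl = q⊆p∪q (σ ─ τ) (prefix last) (∈-subsetOf⁺ (precedes? last) (j , j<last , refl))
      where
      j<last : toℕ j < toℕ last
      j<last = ℕₚ.≤∧≢⇒< (last-greatest j) (λ j≡last → x∈p-y⇒x≢y σ y∈σ-e (cong e (Fₚ.toℕ-injective j≡last)))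

  retag : ∀ i → Dec (i ≡ last) → Tile (suc m)
  retag i (yes _) = topCritical (simplex (tile i)) here
  retag i (no  _) = tile i

  tile′ : Fin N → Tile (suc m)
  tile′ i = retag i (i Fₚ.≟ last)

  private
    inTile⇔ : ∀ ρ → InTile (openSimplex (simplex T) (nonempty T)) ρ ⇔ InTile T ρ
    inTile⇔ ρ = ⇔-trans (least≡simplex⇒isOpen {t = openSimplex (simplex T) (nonempty T)} refl ρ)
                        (⇔-sym (critical-facet⇒isOpen {t = T} T-crit κ≡σ-v v∈σ ρ))

    removed⇔ : ∀ ρ → removed (openSimplex (simplex T) (nonempty T)) ρ ⇔ removed T ρ
    removed⇔ ρ = mk⇔ (map₂ λ ρ∉T′ ρ∈T → ρ∉T′ (from (inTile⇔ ρ) ρ∈T)) (map₂ λ ρ∉T ρ∈T′ → ρ∉T (to (inTile⇔ ρ) ρ∈T′))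

    retag-simplex : ∀ i d → simplex (tile i) ≡ simplex (retag i d)
    retag-simplex i (yes _) = refl
    retag-simplex i (no  _) = refl

    retag-inTile : ∀ i d ρ → InTile (tile i) ρ ⇔ InTile (retag i d) ρ
    retag-inTile i (yes refl) ρ =
      ⇔-trans (least≡simplex⇒isOpen {t = tile last} coneLeast-last ρ)
              (⇔-sym (critical-facet⇒isOpen {t = topCritical (simplex (tile last)) here} refl refl here ρ))
    retag-inTile i (no  _)    ρ = ⇔-refl

    retag-critical⇒last : ∀ i d → kind (retag i d) ≡ critical → i ≡ last
    retag-critical⇒last i (yes i≡last) _    = i≡last
    retag-critical⇒last i (no  _)      crit with () ← proj₁ (to (kind-tile≡critical⇔ {i}) crit)

    order-last : ∣ (true ∷ (σ - e last)) - F.zero ∣ ≡ order T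
    order-last = begin
      ∣ (true ∷ (σ - e last)) - F.zero ∣ ≡⟨ ℕₚ.suc-injective (suc∣p-x∣≡∣p∣ {x = F.zero} (true ∷ (σ - e last)) here) ⟩
      ∣ σ - e last ∣                     ≡⟨ ∣p-x∣≡∣p-y∣ (e-∈σ last) v∈σ ⟩
      ∣ σ - v ∣                          ≡⟨ cong ∣_∣ κ≡σ-v ⟨
      ∣ least T ∣                        ∎
      where open ≡-Reasoning

    retag-last : ∀ d → kind (retag last d) ≡ critical × order (retag last d) ≡ order T
    retag-last (yes _)     = refl , order-last
    retag-last (no  ≢last) = ⊥-elim (≢last refl)

  hTiling : SubdivisionHTiling T τ
  hTiling =
    N , tile′ ,
    isShellableTiling-resp (λ F → mk⇔ (stSub-resp removed⇔ F) (stSub-resp (⇔-sym ∘ removed⇔) F))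
                           (λ i → retag-simplex i (i Fₚ.≟ last)) (λ i → retag-inTile i (i Fₚ.≟ last)) shellable ,
    (λ _ → T-crit) ,
    λ _ → last , proj₁ (retag-last (last Fₚ.≟ last)) , proj₂ (retag-last (last Fₚ.≟ last)) ,
          λ j crit → retag-critical⇒last j (j Fₚ.≟ last) crit

corollary3p1 : ∀ {m} (T : Tile m) (τ : Subset m) →
    τ ⊆ simplex T → Nonempty τ → ¬ (τ ⊆ morseFace T) →
    Σ ℕ λ N → Σ (Fin N → Tile (suc m)) λ ts →
      IsShellableTiling (st τ (closure (simplex T))) (stSub τ (removed T)) ts
      × ((Σ (Fin N) λ i → kind (ts i) ≡ critical) → kind T ≡ critical)
      × (kind T ≡ critical →
          Σ (Fin N) λ i → kind (ts i) ≡ critical × order (ts i) ≡ order T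
            × (∀ j → kind (ts j) ≡ critical → j ≡ i))
corollary3p1 T τ τ⊆σ τ≢∅ τ⊈morse with critical? (kind T) ×-dec τ ⊆? least T
... | no ¬[T-crit×τ⊆κ] = coneHTiling T τ τ⊆σ τ≢∅ λ T-crit τ⊆κ → ¬[T-crit×τ⊆κ] (T-crit , τ⊆κ)
... | yes (T-crit , τ⊆κ) with least≡facet T T-crit (λ big → τ⊈morse (subst (τ ⊆_) (sym (morseFace≡least T T-crit 1≤∣κ∣ big)) τ⊆κ))
  where
  1≤∣κ∣ : 1 ≤ ∣ least T ∣
  1≤∣κ∣ = ℕₚ.≤-trans (s≤s z≤n) (x∈p⇒∣p-x∣<∣p∣ (τ⊆κ (proj₂ τ≢∅)))
... | v , v∈σ , κ≡σ-v = CriticalOpenSimplex.hTiling T τ τ⊆σ τ≢∅ T-crit v∈σ κ≡σ-v
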